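{- Let $m \ge 2$ and $n \ge 1$ be integers. There exists a polynomial $P(X_1,\ldots,X_n) \in \mathbb{R}[X_1,\ldots,X_n]$ that weakly sign represents the parity function over $\{0,1,\ldots,m-1\}^n$, whose degree in each variable $X_i$ is at most $m-1$, and whose sparsity is exactly $(m-1)^n$.
   Context: For $A \subseteq \mathbb{Z}$, the parity function $\mathrm{Par}: A^n \to \{0,1\}$ is $\mathrm{Par}(a_1,\ldots,a_n) = \sum_{i=1}^n a_i \bmod 2$. A polynomial $P$ weakly sign represents $f: A^n \to \{0,1\}$ if for every $a \in A^n$: $f(a) = 0 \Rightarrow P(a) \ge 0$ and $f(a) = 1 \Rightarrow P(a) \le 0$, and $P(a) \neq 0$ for at least one $a \in A^n$. The sparsity of $P$ is the number of monomials with nonzero coefficient in the standard monomial basis. -}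

module Defs where

open import Data.Nat as ℕ using (ℕ; zero; suc; _∸_; _%_)
open import Data.Integer as ℤ using (ℤ; +_; _*_; _^_)
open import Data.Fin using (Fin; toℕ)
open import Data.Vec as Vec using (Vec; []; _∷_; lookup)
open import Data.List as List using (List; [_]; allFin; concatMap; filter; length)
open import Data.Product using (Σ; ∃; _×_)
open import Relation.Nullary using (¬_; ¬?)
open import Relation.Binary.PropositionalEquality using (_≡_; _≢_)

allVecs : (k n : ℕ) → List (Vec (Fin k) n)
allVecs k zero    = [ [] ]
allVecs k (suc n) = concatMap (λ i → List.map (i ∷_) (allVecs k n)) (allFin k)

-- A polynomial in n variables X_1..X_n with integer coefficients, given in the
-- standard monomial basis: 'bound' is some bound D on the exponents of all
-- variables, and 'coeff e' is the coefficient of the monomial X^e = ∏ X_i^(e_i),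
-- for exponent vectors e ∈ {0..D}^n.
record Poly (n : ℕ) : Set where
  field
    bound : ℕ
    coeff : Vec (Fin (suc bound)) n → ℤ
open Poly public

monomial : ∀ {n k} → Vec (Fin k) n → Vec ℤ n → ℤ
monomial []      []      = + 1
monomial (e ∷ es) (x ∷ xs) = (x ^ toℕ e) * monomial es xs

eval : ∀ {n} → Poly n → Vec ℤ n → ℤ
eval {n} P a = List.foldr ℤ._+_ (+ 0) (List.map (λ e → coeff P e * monomial e a) (allVecs (suc (bound P)) n))

sparsity : ∀ {n} → Poly n → ℕ
sparsity {n} P = length (filter (λ e → ¬? (coeff P e ℤ.≟ + 0)) (allVecs (suc (bound P)) n))

IndivDegreeAtMost : ∀ {n} → Poly n → ℕ → Set
IndivDegreeAtMost {n} P d =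
  ∀ (e : Vec (Fin (suc (bound P))) n) → coeff P e ≢ + 0 → ∀ (i : Fin n) → toℕ (lookup e i) ℕ.≤ d

gridPoint : ∀ {m n} → Vec (Fin m) n → Vec ℤ n
gridPoint = Vec.map (λ x → + toℕ x)

Par : ∀ {m n} → Vec (Fin m) n → ℕ
Par a = Vec.sum (Vec.map toℕ a) % 2

WeaklySignRepresents : ∀ {n} → Poly n → (m : ℕ) → (Vec (Fin m) n → ℕ) → Set
WeaklySignRepresents {n} P m f =
  (∀ (a : Vec (Fin m) n) →
     (f a ≡ 0 → + 0 ℤ.≤ eval P (gridPoint a)) ×
     (f a ≡ 1 → eval P (gridPoint a) ℤ.≤ + 0)) ×
  (∃ λ (a : Vec (Fin m) n) → eval P (gridPoint a) ≢ + 0)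

{-# OPTIONS --safe #-}
-- Let u(y) = -y (2 - y)(3 - y) ⋯ (m - 1 - y) and P(X) = u(X₁) ⋯ u(Xₙ).  On {0, …, m - 1}
-- the polynomial u vanishes except at 1, where it is negative, so (-1)ʲ u(j) ≥ 0 for every
-- grid value j; multiplying over the coordinates gives (-1)^(a₁ + ⋯ + aₙ) P(a) ≥ 0, which is
-- weak sign representation of parity, and P(1, …, 1) = u(1)ⁿ ≠ 0.  The coefficient of X^e in
-- P is u_{e₁} ⋯ u_{eₙ}; since u₀ = 0 while u₁, …, u_{m-1} are nonzero (up to sign they are
-- the coefficients of (y + 2) ⋯ (y + m - 1), which are positive), exactly the (m - 1)ⁿ
-- exponent vectors in {1, …, m - 1}ⁿ carry a nonzero coefficient.
module Submission where

open import Defs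
open import Data.Nat using (ℕ; _≤_; _∸_; _^_)
open import Data.Product using (∃; _×_)
open import Relation.Binary.PropositionalEquality using (_≡_)

open import Data.Nat as ℕ using (zero; suc; z≤n; s≤s; _<_; z<s; _%_; _/_; _!)
import Data.Nat.Properties as ℕₚ
open import Data.Nat.DivMod using (m≡m%n+[m/n]*n)
open import Data.Integer as ℤ using (ℤ; +_; -_; _+_; _*_; 0ℤ; 1ℤ; -1ℤ; +≤+)
import Data.Integer.Properties as ℤₚ
open import Data.Integer.Tactic.RingSolver using (solve-∀)
open import Data.Fin as Fin using (Fin; toℕ; zero; suc)
open import Data.Fin.Properties using (toℕ<n; toℕ≤pred[n])
open import Data.Vec as Vec using (Vec; []; _∷_; lookup)
open import Data.Vec.Relation.Unary.All using (All; []; _∷_)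
open import Data.List as List using (List; []; _∷_; _++_; allFin; concatMap; filter; length)
import Data.List.Properties as Listₚ
import Data.List.Relation.Unary.All as ListAll
open import Data.Product using (_,_)
open import Data.Sum using (inj₁; inj₂; [_,_]′)
open import Data.Bool using (true; false)
open import Function using (_∘_; id)
open import Relation.Nullary using (¬?; does)
open import Relation.Unary using (Decidable)
open import Relation.Binary.PropositionalEquality
  using (_≢_; refl; sym; trans; cong; cong₂; subst; module ≡-Reasoning)
open import Algebra.Properties.CommutativeSemigroup ℤₚ.*-commutativeSemigroup
  using () renaming (interchange to *-interchange; x∙yz≈y∙xz to *-left-commute)
open ≡-Reasoning

∑ : List ℤ → ℤ
∑ = List.foldr _+_ 0ℤ

∑-++ : ∀ xs ys → ∑ (xs ++ ys) ≡ ∑ xs + ∑ ys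
∑-++ []       ys = sym (ℤₚ.+-identityˡ (∑ ys))
∑-++ (x ∷ xs) ys = trans (cong (_+_ x) (∑-++ xs ys)) (sym (ℤₚ.+-assoc x (∑ xs) (∑ ys)))

∑-map-concatMap : ∀ {A B : Set} (g : B → ℤ) (h : A → List B) xs →
  ∑ (List.map g (concatMap h xs)) ≡ ∑ (List.map (λ x → ∑ (List.map g (h x))) xs)
∑-map-concatMap g h []       = refl
∑-map-concatMap g h (x ∷ xs) = begin
  ∑ (List.map g (h x ++ concatMap h xs))
    ≡⟨ cong ∑ (Listₚ.map-++ g (h x) _) ⟩
  ∑ (List.map g (h x) ++ List.map g (concatMap h xs))
    ≡⟨ ∑-++ (List.map g (h x)) _ ⟩
  ∑ (List.map g (h x)) + ∑ (List.map g (concatMap h xs))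
    ≡⟨ cong (_+_ (∑ (List.map g (h x)))) (∑-map-concatMap g h xs) ⟩
  ∑ (List.map g (h x)) + ∑ (List.map (λ y → ∑ (List.map g (h y))) xs) ∎

∑-map-*ˡ : ∀ {A : Set} c (f : A → ℤ) xs →
  ∑ (List.map (λ x → c * f x) xs) ≡ c * ∑ (List.map f xs)
∑-map-*ˡ c f []       = sym (ℤₚ.*-zeroʳ c)
∑-map-*ˡ c f (x ∷ xs) =
  trans (cong (_+_ (c * f x)) (∑-map-*ˡ c f xs)) (sym (ℤₚ.*-distribˡ-+ c (f x) _))

∑-map-*ʳ : ∀ {A : Set} c (f : A → ℤ) xs →
  ∑ (List.map (λ x → f x * c) xs) ≡ ∑ (List.map f xs) * c
∑-map-*ʳ c f []       = refl
∑-map-*ʳ c f (x ∷ xs) =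
  trans (cong (_+_ (f x * c)) (∑-map-*ʳ c f xs)) (sym (ℤₚ.*-distribʳ-+ c (f x) _))

length-filter-map : ∀ {A B : Set} {P : B → Set} (P? : Decidable P) (f : A → B) xs →
  length (filter P? (List.map f xs)) ≡ length (filter (P? ∘ f) xs)
length-filter-map P? f []       = refl
length-filter-map P? f (x ∷ xs) with does (P? (f x))
... | true  = cong suc (length-filter-map P? f xs)
... | false = length-filter-map P? f xs

length-filter-concatMap : ∀ {A B : Set} {P : B → Set} (P? : Decidable P) (f : A → List B) {c} →
  (∀ x → length (filter P? (f x)) ≡ c) →
  ∀ xs → length (filter P? (concatMap f xs)) ≡ length xs ℕ.* c
length-filter-concatMap P? f count-f []       = refl
length-filter-concatMap P? f count-f (x ∷ xs) = begin
  length (filter P? (f x ++ concatMap f xs))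
    ≡⟨ cong length (Listₚ.filter-++ P? (f x) _) ⟩
  length (filter P? (f x) ++ filter P? (concatMap f xs))
    ≡⟨ Listₚ.length-++ (filter P? (f x)) ⟩
  length (filter P? (f x)) ℕ.+ length (filter P? (concatMap f xs))
    ≡⟨ cong₂ ℕ._+_ (count-f x) (length-filter-concatMap P? f count-f xs) ⟩
  _ ℕ.+ length xs ℕ.* _ ∎

tabulate-suc : ∀ n → List.tabulate {n = n} Fin.suc ≡ List.map Fin.suc (allFin n)
tabulate-suc n = sym (Listₚ.map-tabulate id Fin.suc)

horner : ∀ {n} → Vec ℤ n → ℤ → ℤ
horner []       y = 0ℤ
horner (a ∷ as) y = a + y * horner as y

∑-monomials≡horner : ∀ {n} (v : Vec ℤ n) y →
  ∑ (List.map (λ i → lookup v i * y ℤ.^ toℕ i) (allFin n)) ≡ horner v y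
∑-monomials≡horner []       y = refl
∑-monomials≡horner {suc n} (a ∷ as) y = cong₂ _+_ (ℤₚ.*-identityʳ a) (begin
  ∑ (List.map term (List.tabulate Fin.suc))
    ≡⟨ cong (∑ ∘ List.map term) (tabulate-suc n) ⟩
  ∑ (List.map term (List.map Fin.suc (allFin n)))
    ≡⟨ cong ∑ (sym (Listₚ.map-∘ (allFin n))) ⟩
  ∑ (List.map (λ i → lookup as i * (y * y ℤ.^ toℕ i)) (allFin n))
    ≡⟨ cong ∑ (Listₚ.map-cong (λ i → *-left-commute (lookup as i) y (y ℤ.^ toℕ i)) (allFin n)) ⟩
  ∑ (List.map (λ i → y * (lookup as i * y ℤ.^ toℕ i)) (allFin n))
    ≡⟨ ∑-map-*ˡ y _ (allFin n) ⟩
  y * ∑ (List.map (λ i → lookup as i * y ℤ.^ toℕ i) (allFin n))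
    ≡⟨ cong (y *_) (∑-monomials≡horner as y) ⟩
  y * horner as y ∎)
  where
  term : Fin (suc n) → ℤ
  term i = lookup (a ∷ as) i * y ℤ.^ toℕ i

tensorCoeff : ∀ {k n} → Vec ℤ k → Vec (Fin k) n → ℤ
tensorCoeff U []      = 1ℤ
tensorCoeff U (j ∷ e) = lookup U j * tensorCoeff U e

tensorPower : ∀ {d} → Vec ℤ (suc d) → (n : ℕ) → Poly n
tensorPower {d} U n = record { bound = d ; coeff = tensorCoeff U }

∏ : ∀ {n} → (ℤ → ℤ) → Vec ℤ n → ℤ
∏ f []       = 1ℤ
∏ f (x ∷ xs) = f x * ∏ f xs

eval-tensorPower : ∀ {d n} (U : Vec ℤ (suc d)) (a : Vec ℤ n) →
  eval (tensorPower U n) a ≡ ∏ (horner U) a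
eval-tensorPower U []                   = refl
eval-tensorPower {d} {suc n} U (x ∷ xs) = begin
  eval (tensorPower U (suc n)) (x ∷ xs)
    ≡⟨⟩
  ∑ (List.map term (concatMap row (allFin (suc d))))
    ≡⟨ ∑-map-concatMap term row (allFin (suc d)) ⟩
  ∑ (List.map (λ j → ∑ (List.map term (row j))) (allFin (suc d)))
    ≡⟨ cong ∑ (Listₚ.map-cong row-sum (allFin (suc d))) ⟩
  ∑ (List.map (λ j → monomialⱼ j * ∏ (horner U) xs) (allFin (suc d)))
    ≡⟨ ∑-map-*ʳ (∏ (horner U) xs) monomialⱼ (allFin (suc d)) ⟩
  ∑ (List.map monomialⱼ (allFin (suc d))) * ∏ (horner U) xs
    ≡⟨ cong (_* ∏ (horner U) xs) (∑-monomials≡horner U x) ⟩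
  horner U x * ∏ (horner U) xs ∎
  where
  W : List (Vec (Fin (suc d)) n)
  W = allVecs (suc d) n
  row : Fin (suc d) → List (Vec (Fin (suc d)) (suc n))
  row j = List.map (j ∷_) W
  term : Vec (Fin (suc d)) (suc n) → ℤ
  term e = tensorCoeff U e * monomial e (x ∷ xs)
  monomialⱼ : Fin (suc d) → ℤ
  monomialⱼ j = lookup U j * x ℤ.^ toℕ j
  row-sum : ∀ j → ∑ (List.map term (row j)) ≡ monomialⱼ j * ∏ (horner U) xs
  row-sum j = begin
    ∑ (List.map term (row j))
      ≡⟨ cong ∑ (sym (Listₚ.map-∘ W)) ⟩
    ∑ (List.map (λ e → (lookup U j * tensorCoeff U e) * (x ℤ.^ toℕ j * monomial e xs)) W)
      ≡⟨ cong ∑ (Listₚ.map-cong (λ e → *-interchange (lookup U j) _ _ _) W) ⟩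
    ∑ (List.map (λ e → monomialⱼ j * (tensorCoeff U e * monomial e xs)) W)
      ≡⟨ ∑-map-*ˡ (monomialⱼ j) _ W ⟩
    monomialⱼ j * eval (tensorPower U n) xs
      ≡⟨ cong (monomialⱼ j *_) (eval-tensorPower U xs) ⟩
    monomialⱼ j * ∏ (horner U) xs ∎

sparsity-tensorPower : ∀ {d} (V : Vec ℤ d) → (∀ j → lookup V j ≢ 0ℤ) →
  ∀ n → sparsity (tensorPower (0ℤ ∷ V) n) ≡ d ^ n
sparsity-tensorPower V V≢0 zero          = refl
sparsity-tensorPower {d} V V≢0 (suc n) = begin
  sparsity (tensorPower U (suc n))
    ≡⟨⟩
  count (row zero ++ concatMap row (List.tabulate Fin.suc))
    ≡⟨ cong length (Listₚ.filter-++ nonzero? (row zero) _) ⟩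
  length (filter nonzero? (row zero) ++ filter nonzero? (concatMap row (List.tabulate Fin.suc)))
    ≡⟨ Listₚ.length-++ (filter nonzero? (row zero)) ⟩
  count (row zero) ℕ.+ count (concatMap row (List.tabulate Fin.suc))
    ≡⟨ cong₂ ℕ._+_ count-row-zero (cong (count ∘ concatMap row) (tabulate-suc d)) ⟩
  count (concatMap row (List.map Fin.suc (allFin d)))
    ≡⟨ cong count (Listₚ.concatMap-map row Fin.suc (allFin d)) ⟩
  count (concatMap (row ∘ Fin.suc) (allFin d))
    ≡⟨ length-filter-concatMap nonzero? (row ∘ Fin.suc) count-row-suc (allFin d) ⟩
  length (allFin d) ℕ.* d ^ n
    ≡⟨ cong (ℕ._* d ^ n) (Listₚ.length-tabulate {n = d} id) ⟩
  d ^ suc n ∎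
  where
  U : Vec ℤ (suc d)
  U = 0ℤ ∷ V
  nonzero? : ∀ {k} → Decidable (λ (e : Vec (Fin (suc d)) k) → tensorCoeff U e ≢ 0ℤ)
  nonzero? e = ¬? (tensorCoeff U e ℤ.≟ 0ℤ)
  count : ∀ {k} → List (Vec (Fin (suc d)) k) → ℕ
  count es = length (filter nonzero? es)
  W : List (Vec (Fin (suc d)) n)
  W = allVecs (suc d) n
  row : Fin (suc d) → List (Vec (Fin (suc d)) (suc n))
  row j = List.map (j ∷_) W
  count-row-zero : count (row zero) ≡ 0
  count-row-zero = trans (length-filter-map nonzero? (zero ∷_) W)
    (cong length (Listₚ.filter-none (nonzero? ∘ (zero ∷_)) (ListAll.universal (λ _ nz → nz refl) W)))
  count-row-suc : ∀ j → count (row (Fin.suc j)) ≡ d ^ n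
  count-row-suc j = begin
    count (row (Fin.suc j))
      ≡⟨ length-filter-map nonzero? (Fin.suc j ∷_) W ⟩
    length (filter (nonzero? ∘ (Fin.suc j ∷_)) W)
      ≡⟨ cong length (Listₚ.filter-≐ _ nonzero? ((λ {e} → drop-factor e) , (λ {e} → keep-factor e)) W) ⟩
    count W
      ≡⟨ sparsity-tensorPower V V≢0 n ⟩
    d ^ n ∎
    where
    drop-factor : ∀ e → lookup V j * tensorCoeff U e ≢ 0ℤ → tensorCoeff U e ≢ 0ℤ
    drop-factor e nz e≡0 = nz (trans (cong (lookup V j *_) e≡0) (ℤₚ.*-zeroʳ (lookup V j)))
    keep-factor : ∀ e → tensorCoeff U e ≢ 0ℤ → lookup V j * tensorCoeff U e ≢ 0ℤ
    keep-factor e nz Ve≡0 = [ V≢0 j , nz ]′ (ℤₚ.i*j≡0⇒i≡0∨j≡0 (lookup V j) Ve≡0)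

-1^≡-1^[mod2] : ∀ s → -1ℤ ℤ.^ s ≡ -1ℤ ℤ.^ (s % 2)
-1^≡-1^[mod2] s = begin
  -1ℤ ℤ.^ s
    ≡⟨ cong (-1ℤ ℤ.^_) (m≡m%n+[m/n]*n s 2) ⟩
  -1ℤ ℤ.^ (s % 2 ℕ.+ s / 2 ℕ.* 2)
    ≡⟨ ℤₚ.^-distribˡ-+-* -1ℤ (s % 2) _ ⟩
  -1ℤ ℤ.^ (s % 2) * -1ℤ ℤ.^ (s / 2 ℕ.* 2)
    ≡⟨ cong (λ e → -1ℤ ℤ.^ (s % 2) * -1ℤ ℤ.^ e) (ℕₚ.*-comm (s / 2) 2) ⟩
  -1ℤ ℤ.^ (s % 2) * -1ℤ ℤ.^ (2 ℕ.* (s / 2))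
    ≡⟨ cong (-1ℤ ℤ.^ (s % 2) *_) (sym (ℤₚ.^-*-assoc -1ℤ 2 (s / 2))) ⟩
  -1ℤ ℤ.^ (s % 2) * 1ℤ ℤ.^ (s / 2)
    ≡⟨ cong (-1ℤ ℤ.^ (s % 2) *_) (ℤₚ.^-zeroˡ (s / 2)) ⟩
  -1ℤ ℤ.^ (s % 2) * 1ℤ
    ≡⟨ ℤₚ.*-identityʳ _ ⟩
  -1ℤ ℤ.^ (s % 2) ∎

sign-by-parity : ∀ s v → 0ℤ ℤ.≤ -1ℤ ℤ.^ s * v →
  (s % 2 ≡ 0 → 0ℤ ℤ.≤ v) × (s % 2 ≡ 1 → v ℤ.≤ 0ℤ)
sign-by-parity s v 0≤±v = even , odd
  where
  even : s % 2 ≡ 0 → 0ℤ ℤ.≤ v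
  even s-even = subst (0ℤ ℤ.≤_) (begin
    -1ℤ ℤ.^ s * v
      ≡⟨ cong (_* v) (trans (-1^≡-1^[mod2] s) (cong (-1ℤ ℤ.^_) s-even)) ⟩
    1ℤ * v
      ≡⟨ ℤₚ.*-identityˡ v ⟩
    v ∎) 0≤±v
  odd : s % 2 ≡ 1 → v ℤ.≤ 0ℤ
  odd s-odd = ℤₚ.neg-cancel-≤ (subst (0ℤ ℤ.≤_) (begin
    -1ℤ ℤ.^ s * v
      ≡⟨ cong (_* v) (trans (-1^≡-1^[mod2] s) (cong (-1ℤ ℤ.^_) s-odd)) ⟩
    -1ℤ * v
      ≡⟨ ℤₚ.-1*i≡-i v ⟩
    - v ∎) 0≤±v)

0≤i∧0≤j⇒0≤i*j : ∀ {i j} → 0ℤ ℤ.≤ i → 0ℤ ℤ.≤ j → 0ℤ ℤ.≤ i * j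
0≤i∧0≤j⇒0≤i*j {+ a} {+ b} _ _ = subst (0ℤ ℤ.≤_) (ℤₚ.pos-* a b) (+≤+ z≤n)

alternating-∏-nonneg : ∀ {m n} (f : ℤ → ℤ) →
  (∀ (j : Fin m) → 0ℤ ℤ.≤ -1ℤ ℤ.^ toℕ j * f (+ toℕ j)) →
  ∀ (a : Vec (Fin m) n) → 0ℤ ℤ.≤ -1ℤ ℤ.^ Vec.sum (Vec.map toℕ a) * ∏ f (gridPoint a)
alternating-∏-nonneg f f-alt []      = +≤+ z≤n
alternating-∏-nonneg f f-alt (j ∷ a) =
  subst (0ℤ ℤ.≤_) (sym regroup) (0≤i∧0≤j⇒0≤i*j (f-alt j) (alternating-∏-nonneg f f-alt a))
  where
  s : ℕ
  s = Vec.sum (Vec.map toℕ a)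
  regroup : -1ℤ ℤ.^ (toℕ j ℕ.+ s) * (f (+ toℕ j) * ∏ f (gridPoint a))
          ≡ (-1ℤ ℤ.^ toℕ j * f (+ toℕ j)) * (-1ℤ ℤ.^ s * ∏ f (gridPoint a))
  regroup = trans (cong (_* (f (+ toℕ j) * ∏ f (gridPoint a))) (ℤₚ.^-distribˡ-+-* -1ℤ (toℕ j) s))
    (*-interchange (-1ℤ ℤ.^ toℕ j) (-1ℤ ℤ.^ s) (f (+ toℕ j)) (∏ f (gridPoint a)))

hornerℕ : ∀ {n} → Vec ℕ n → ℤ → ℤ
hornerℕ v = horner (Vec.map +_ v)

linearMulAdd : ∀ {n} → ℕ → ℕ → Vec ℕ n → Vec ℕ (suc n)
linearMulAdd c p []       = p ∷ []
linearMulAdd c p (a ∷ as) = c ℕ.* a ℕ.+ p ∷ linearMulAdd c a as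

hornerℕ-linearMulAdd : ∀ {n} c p (v : Vec ℕ n) y →
  hornerℕ (linearMulAdd c p v) y ≡ (+ c + y) * hornerℕ v y + + p
hornerℕ-linearMulAdd c p []       y = ring (+ c) (+ p) y
  where
  ring : ∀ c p y → p + y * 0ℤ ≡ (c + y) * 0ℤ + p
  ring = solve-∀
hornerℕ-linearMulAdd c p (a ∷ as) y = begin
  + (c ℕ.* a ℕ.+ p) + y * hornerℕ (linearMulAdd c a as) y
    ≡⟨ cong₂ _+_ (trans (ℤₚ.pos-+ (c ℕ.* a) p) (cong (_+ + p) (ℤₚ.pos-* c a)))
                 (cong (y *_) (hornerℕ-linearMulAdd c a as y)) ⟩
  + c * + a + + p + y * ((+ c + y) * hornerℕ as y + + a)
    ≡⟨ ring (+ c) (+ a) (+ p) y (hornerℕ as y) ⟩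
  (+ c + y) * (+ a + y * hornerℕ as y) + + p ∎
  where
  ring : ∀ c a p y h → c * a + p + y * ((c + y) * h + a) ≡ (c + y) * (a + y * h) + p
  ring = solve-∀

linearMulAdd-positive : ∀ {n c p} {v : Vec ℕ (suc n)} →
  0 < c → All (0 <_) v → All (0 <_) (linearMulAdd c p v)
linearMulAdd-positive z<s (z<s ∷ [])            = z<s ∷ z<s ∷ []
linearMulAdd-positive z<s (z<s ∷ as>0@(_ ∷ _)) = z<s ∷ linearMulAdd-positive z<s as>0

-- Coefficients of (y + 2)(y + 3) ⋯ (y + t + 1).
rising : (t : ℕ) → Vec ℕ (suc t)
rising zero    = 1 ∷ []
rising (suc t) = linearMulAdd (2 ℕ.+ t) 0 (rising t)

hornerℕ-rising-suc : ∀ t y → hornerℕ (rising (suc t)) y ≡ (+ (2 ℕ.+ t) + y) * hornerℕ (rising t) y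
hornerℕ-rising-suc t y = trans (hornerℕ-linearMulAdd (2 ℕ.+ t) 0 (rising t) y) (ℤₚ.+-identityʳ _)

rising-positive : ∀ t → All (0 <_) (rising t)
rising-positive zero    = z<s ∷ []
rising-positive (suc t) = linearMulAdd-positive z<s (rising-positive t)

rising-root : ∀ {s t} → s < t → hornerℕ (rising t) (- + (2 ℕ.+ s)) ≡ 0ℤ
rising-root {s} {suc t} s<1+t
  rewrite hornerℕ-rising-suc t (- + (2 ℕ.+ s)) with ℕₚ.m<1+n⇒m<n∨m≡n s<1+t
... | inj₂ refl = cong (_* hornerℕ (rising t) (- + (2 ℕ.+ t))) (ℤₚ.+-inverseʳ (+ (2 ℕ.+ t)))
... | inj₁ s<t  = trans (cong (factor *_) (rising-root s<t)) (ℤₚ.*-zeroʳ factor)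
  where
  factor : ℤ
  factor = + (2 ℕ.+ t) + - + (2 ℕ.+ s)

hornerℕ-rising-neg1 : ∀ t → hornerℕ (rising t) -1ℤ ≡ + (t !)
hornerℕ-rising-neg1 zero    = refl
hornerℕ-rising-neg1 (suc t) = begin
  hornerℕ (rising (suc t)) -1ℤ
    ≡⟨ hornerℕ-rising-suc t -1ℤ ⟩
  (+ (2 ℕ.+ t) + -1ℤ) * hornerℕ (rising t) -1ℤ
    ≡⟨ cong (+ suc t *_) (hornerℕ-rising-neg1 t) ⟩
  + suc t * + (t !)
    ≡⟨ ℤₚ.pos-* (suc t) (t !) ⟨
  + (suc t !) ∎

alternate : ∀ {n} → ℤ → Vec ℕ n → Vec ℤ n
alternate s []       = []
alternate s (a ∷ as) = s * + a ∷ alternate (- s) as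

horner-alternate : ∀ {n} s (v : Vec ℕ n) y → horner (alternate s v) y ≡ s * hornerℕ v (- y)
horner-alternate s []       y = sym (ℤₚ.*-zeroʳ s)
horner-alternate s (a ∷ as) y = begin
  s * + a + y * horner (alternate (- s) as) y
    ≡⟨ cong (λ h → s * + a + y * h) (horner-alternate (- s) as y) ⟩
  s * + a + y * (- s * hornerℕ as (- y))
    ≡⟨ ring s (+ a) y (hornerℕ as (- y)) ⟩
  s * (+ a + - y * hornerℕ as (- y)) ∎
  where
  ring : ∀ s a y h → s * a + y * (- s * h) ≡ s * (a + - y * h)
  ring = solve-∀

alternate-nonzero : ∀ {n s} {v : Vec ℕ n} → s ≢ 0ℤ → All (0 <_) v →
  ∀ j → lookup (alternate s v) j ≢ 0ℤ
alternate-nonzero {s = s} s≢0 (z<s ∷ _) zero sa≡0 =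
  [ s≢0 , (λ ()) ]′ (ℤₚ.i*j≡0⇒i≡0∨j≡0 s sa≡0)
alternate-nonzero {s = s} s≢0 (_ ∷ v>0) (suc j) =
  alternate-nonzero (s≢0 ∘ ℤₚ.neg-injective {s} {0ℤ}) v>0 j

uCoeffs : (k : ℕ) → Vec ℤ (suc (suc k))
uCoeffs k = 0ℤ ∷ alternate -1ℤ (rising k)

horner-uCoeffs : ∀ k y → horner (uCoeffs k) y ≡ - (y * hornerℕ (rising k) (- y))
horner-uCoeffs k y = begin
  0ℤ + y * horner (alternate -1ℤ (rising k)) y
    ≡⟨ ℤₚ.+-identityˡ _ ⟩
  y * horner (alternate -1ℤ (rising k)) y
    ≡⟨ cong (y *_) (horner-alternate -1ℤ (rising k) y) ⟩
  y * (-1ℤ * hornerℕ (rising k) (- y))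
    ≡⟨ cong (y *_) (ℤₚ.-1*i≡-i _) ⟩
  y * - hornerℕ (rising k) (- y)
    ≡⟨ ℤₚ.neg-distribʳ-* y _ ⟨
  - (y * hornerℕ (rising k) (- y)) ∎

horner-uCoeffs-one : ∀ k → horner (uCoeffs k) 1ℤ ≡ - + (k !)
horner-uCoeffs-one k =
  trans (horner-uCoeffs k 1ℤ) (cong -_ (trans (ℤₚ.*-identityˡ _) (hornerℕ-rising-neg1 k)))

horner-uCoeffs-one≢0 : ∀ k → horner (uCoeffs k) 1ℤ ≢ 0ℤ
horner-uCoeffs-one≢0 k u1≡0 = ℕ.≢-nonZero⁻¹ (k !) {{k ℕₚ.!≢0}}
  (ℤₚ.+-injective (ℤₚ.neg-injective {+ (k !)} {0ℤ} (trans (sym (horner-uCoeffs-one k)) u1≡0)))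

horner-uCoeffs-root : ∀ k (s : Fin k) → horner (uCoeffs k) (+ (2 ℕ.+ toℕ s)) ≡ 0ℤ
horner-uCoeffs-root k s = begin
  horner (uCoeffs k) y
    ≡⟨ horner-uCoeffs k y ⟩
  - (y * hornerℕ (rising k) (- y))
    ≡⟨ cong (λ h → - (y * h)) (rising-root (toℕ<n s)) ⟩
  - (y * 0ℤ)
    ≡⟨ cong -_ (ℤₚ.*-zeroʳ y) ⟩
  0ℤ ∎
  where
  y : ℤ
  y = + (2 ℕ.+ toℕ s)

uCoeffs-alternating : ∀ k (j : Fin (suc (suc k))) →
  0ℤ ℤ.≤ -1ℤ ℤ.^ toℕ j * horner (uCoeffs k) (+ toℕ j)
uCoeffs-alternating k zero          = +≤+ z≤n
uCoeffs-alternating k (suc zero)    = subst (0ℤ ℤ.≤_) (sym (begin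
  -1ℤ * horner (uCoeffs k) 1ℤ
    ≡⟨ cong (-1ℤ *_) (horner-uCoeffs-one k) ⟩
  -1ℤ * - + (k !)
    ≡⟨ ℤₚ.-1*i≡-i _ ⟩
  - - + (k !)
    ≡⟨ ℤₚ.neg-involutive _ ⟩
  + (k !) ∎)) (+≤+ z≤n)
uCoeffs-alternating k (suc (suc s)) = ℤₚ.≤-reflexive (sym (begin
  -1ℤ ℤ.^ (2 ℕ.+ toℕ s) * horner (uCoeffs k) (+ (2 ℕ.+ toℕ s))
    ≡⟨ cong (-1ℤ ℤ.^ (2 ℕ.+ toℕ s) *_) (horner-uCoeffs-root k s) ⟩
  -1ℤ ℤ.^ (2 ℕ.+ toℕ s) * 0ℤ
    ≡⟨ ℤₚ.*-zeroʳ (-1ℤ ℤ.^ (2 ℕ.+ toℕ s)) ⟩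
  0ℤ ∎))

∏-gridPoint-replicate : ∀ {m} n (f : ℤ → ℤ) (j : Fin m) →
  ∏ f (gridPoint (Vec.replicate n j)) ≡ f (+ toℕ j) ℤ.^ n
∏-gridPoint-replicate zero    f j = refl
∏-gridPoint-replicate (suc n) f j = cong (f (+ toℕ j) *_) (∏-gridPoint-replicate n f j)

lemma3p12 : ∀ (m n : ℕ) → 2 ≤ m → 1 ≤ n →
  ∃ λ (P : Poly n) →
    WeaklySignRepresents P m Par ×
    IndivDegreeAtMost P (m ∸ 1) ×
    sparsity P ≡ (m ∸ 1) ^ n
lemma3p12 (suc (suc k)) n (s≤s (s≤s z≤n)) _ =
  P , (signs , ones , nonvanishing) , degree , sparsity-tensorPower (alternate -1ℤ (rising k)) coeffs≢0 n
  where
  u : ℤ → ℤ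
  u = horner (uCoeffs k)
  P : Poly n
  P = tensorPower (uCoeffs k) n
  signs : ∀ a → (Par a ≡ 0 → 0ℤ ℤ.≤ eval P (gridPoint a)) ×
                (Par a ≡ 1 → eval P (gridPoint a) ℤ.≤ 0ℤ)
  signs a = sign-by-parity (Vec.sum (Vec.map toℕ a)) (eval P (gridPoint a))
    (subst (λ v → 0ℤ ℤ.≤ -1ℤ ℤ.^ Vec.sum (Vec.map toℕ a) * v)
           (sym (eval-tensorPower (uCoeffs k) (gridPoint a)))
           (alternating-∏-nonneg u (uCoeffs-alternating k) a))
  ones : Vec (Fin (suc (suc k))) n
  ones = Vec.replicate n (suc zero)
  nonvanishing : eval P (gridPoint ones) ≢ 0ℤ
  nonvanishing P≡0 = horner-uCoeffs-one≢0 k (ℤₚ.i^n≡0⇒i≡0 (u 1ℤ) n (begin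
    u 1ℤ ℤ.^ n
      ≡⟨ ∏-gridPoint-replicate n u (suc zero) ⟨
    ∏ u (gridPoint ones)
      ≡⟨ eval-tensorPower (uCoeffs k) (gridPoint ones) ⟨
    eval P (gridPoint ones)
      ≡⟨ P≡0 ⟩
    0ℤ ∎))
  degree : IndivDegreeAtMost P (suc k)
  degree e _ i = toℕ≤pred[n] (lookup e i)
  coeffs≢0 : ∀ j → lookup (alternate -1ℤ (rising k)) j ≢ 0ℤ
  coeffs≢0 = alternate-nonzero (λ ()) (rising-positive k)
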